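{- Let $X$ be a finite set, $Y\subseteq X$, $C_n=\langle g\rangle$ a cyclic group of order $n$ acting on $X$, and $f(q)\in\mathbb Z[q]$ with non-negative coefficients and $f(1)=|Y|$. Suppose that for every $k\in\{1,\dots,n\}$, $f(\omega_n^k)=|\{y\in Y: g^k\cdot y=y\}|$, where $\omega_n=e^{2\pi i/n}$. Then there is an action of a cyclic group $\hat C_n$ of order $n$ on $Y$ such that $(Y,\hat C_n,f(q))$ exhibits the cyclic sieving phenomenon.
   Context: A triple $(Z,C,f(q))$, with $Z$ a finite set, $C=\langle h\rangle$ a cyclic group of order $n$ acting on $Z$, and $f(q)$ a polynomial with non-negative integer coefficients, exhibits the cyclic sieving phenomenon if $f(\omega_n^k)=|\{z\in Z: h^k\cdot z=z\}|$ for every $k\in\{1,\dots,n\}$. The hypothesis of the proposition says that $(Y\subset X, C_n,f(q))$ is a "subset cyclic sieving phenomenon". -}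

module Defs where

open import Level using (Level; _⊔_)
open import Data.Nat using (ℕ; zero; suc; _≤_; _<_)
open import Data.Fin using (Fin)
open import Data.Fin.Subset using (Subset; _∈_)
open import Data.Fin.Subset.Properties using (_∈?_)
import Data.Fin.Properties as FinP
open import Data.List using (List; []; _∷_; length; filter)
open import Data.Nat.ListAction using (sum)
open import Data.List.Base using (allFin)
open import Data.Product using (_×_)
open import Data.Sum using (_⊎_)
open import Relation.Nullary using (¬_)
open import Relation.Nullary.Decidable using (_×-dec_)
open import Relation.Binary.PropositionalEquality using (_≡_)
open import Algebra.Bundles using (CommutativeRing)

iter : {A : Set} → ℕ → (A → A) → A → A
iter zero    h x = x
iter (suc k) h x = h (iter k h x)

-- A polynomial with non-negative integer coefficients, given by its
-- coefficient list [c₀, c₁, c₂, …] meaning c₀ + c₁ q + c₂ q² + ⋯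
Poly : Set
Poly = List ℕ

evalAt1 : Poly → ℕ
evalAt1 = sum

fixCount : {N : ℕ} → Subset N → (Fin N → Fin N) → ℕ
fixCount {N} Y h = length (filter (λ x → (x ∈? Y) ×-dec (h x FinP.≟ x)) (allFin N))

module _ {c ℓ : Level} (R : CommutativeRing c ℓ) where
  open CommutativeRing R

  ℕ→R : ℕ → Carrier
  ℕ→R zero    = 0#
  ℕ→R (suc m) = 1# + ℕ→R m

  pow : Carrier → ℕ → Carrier
  pow x zero    = 1#
  pow x (suc m) = x * pow x m

  evalR : Poly → Carrier → Carrier
  evalR []       x = 0#
  evalR (c ∷ cs) x = ℕ→R c + x * evalR cs x

  record IsChar0Domain : Set (c ⊔ ℓ) where
    field
      nontrivial : ¬ (1# ≈ 0#)
      noZeroDiv  : ∀ x y → x * y ≈ 0# → (x ≈ 0#) ⊎ (y ≈ 0#)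
      char0      : ∀ m → ¬ (ℕ→R (suc m) ≈ 0#)

  record IsPrimitiveRoot (n : ℕ) (ω : Carrier) : Set ℓ where
    field
      rootOfUnity : pow ω n ≈ 1#
      isPrimitive : ∀ d → 1 ≤ d → d < n → ¬ (pow ω d ≈ 1#)

-- An action of the cyclic group C_n = ⟨g⟩ on X = Fin N is given by the
-- action of its generator g, a map with g^n = id.
IsCnAction : {N : ℕ} → ℕ → (Fin N → Fin N) → Set
IsCnAction n g = ∀ x → iter n g x ≡ x

-- An action of a cyclic group of order n on the subset Y ⊆ Fin N,
-- given by the action of a generator τ: τ maps Y into Y and τ^n = id on Y.
IsCnActionOn : {N : ℕ} → ℕ → Subset N → (Fin N → Fin N) → Set
IsCnActionOn n Y τ = (∀ x → x ∈ Y → τ x ∈ Y) × (∀ x → x ∈ Y → iter n τ x ≡ x)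

module Submission where

-- Write per x for the period of x ∈ Y under g (a divisor of n) and b_d for the number of
-- points of Y of period d.  Only the numbers b_d matter: g^k fixes x exactly when
-- per x ∣ k, so the fixed-point counts of g^k on Y depend only on (b_d).  Hence it is
-- enough to find a map τ on Y under which every x ∈ Y again has period per x, and such a
-- τ exists (cycling blocks of d points) as soon as d ∣ b_d for every d.
--
-- The divisibility d ∣ b_d is where the sieving hypothesis enters.  For every t the
-- transform Σ_{k=1}^{n} f(ωᵏ) ω^{tk} equals n times a sum of coefficients of f (the
-- roots-of-unity filter).  Replacing f(ωᵏ) by the fixed-point counts and summing over
-- the points instead gives Σ_{x ∈ Y} (n / per x) [n ∣ t · per x]; as the ring has
-- characteristic zero, this natural number is therefore a multiple of n.  At t = n / d
-- it is the total cofactor n / e of the points whose period e is a multiple of d, and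
-- downward induction on d yields d ∣ b_d.

open import Defs
open import Level using (Level)
open import Data.Nat as ℕ
  using (ℕ; zero; suc; pred; _≤_; _<_; _%_; NonZero; >-nonZero; >-nonZero⁻¹; ≢-nonZero⁻¹; z≤n; s≤s; s≤s⁻¹)
import Data.Nat.Properties as ℕₚ
open import Data.Nat.DivMod
  using (_mod_; m≡m%n+[m/n]*n; m%n<n; m<n⇒m%n≡m; %-distribˡ-+; m%n%n≡m%n; %-remove-+ʳ)
open import Data.Nat.Divisibility
  using ( _∣_; _∣?_; divides; quotient; m∣n⇒n≡quotient*m; m%n≡0⇒n∣m; _∣0; ∣-refl; ∣⇒≤
        ; ∣m+n∣m⇒∣n; ∣m∣n⇒∣m+n; ∣m⇒∣m*n; ∣n⇒∣m*n; *-cancelˡ-∣; *-monoʳ-∣)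
open import Data.Fin as Fin using (Fin; toℕ; combine; remQuot)
import Data.Fin.Properties as FinP
open import Data.Fin.Subset using (Subset; ∣_∣; _∈_)
open import Data.Fin.Subset.Properties using (_∈?_)
open import Data.List using (List; []; _∷_; length; filter; tabulate; allFin; lookup)
open import Data.List.Relation.Unary.Unique.Propositional using (Unique)
import Data.List.Relation.Unary.Unique.Propositional.Properties as Unique
open import Data.List.Relation.Unary.AllPairs using (_∷_)
import Data.List.Relation.Unary.All as All
open import Data.List.Relation.Unary.Any using (index)
open import Data.List.Relation.Unary.Any.Properties using (lookup-index)
open import Data.List.Membership.Propositional using () renaming (_∈_ to _∈ₗ_)
open import Data.List.Membership.Propositional.Properties using (∈-lookup; ∈-filter⁺; ∈-filter⁻; ∈-allFin)
open import Data.Vec.Functional using (Vector)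
open import Data.Bool using (if_then_else_)
open import Data.Product using (Σ; ∃; _×_; _,_; proj₁; proj₂)
open import Data.Sum using (_⊎_; inj₁; inj₂)
open import Data.Empty using (⊥-elim)
open import Function.Base using (_∘_)
open import Function.Bundles using (_⇔_; mk⇔; Equivalence)
open import Function.Construct.Composition using (_⇔-∘_)
open import Relation.Nullary using (¬_; Dec; yes; no; does; ¬?)
open import Relation.Nullary.Decidable using (_×-dec_)
open import Relation.Unary using (Pred; Decidable)
open import Relation.Binary using (Setoid; DecidableEquality)
open import Relation.Binary.PropositionalEquality as ≡ using (_≡_; cong; cong₂)
open import Algebra.Bundles using (CommutativeRing; Semiring)
import Relation.Binary.Reasoning.Setoid as SetoidReasoning

iter-+ : {A : Set} (h : A → A) (a b : ℕ) (x : A) → iter (a ℕ.+ b) h x ≡ iter a h (iter b h x)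
iter-+ h zero    b x = ≡.refl
iter-+ h (suc a) b x = cong h (iter-+ h a b x)

module PeriodicSequence {c ℓ} (S : Setoid c ℓ) (a : ℕ → Setoid.Carrier S)
  (p : ℕ) .{{_ : NonZero p}} (shift : ∀ k → Setoid._≈_ S (a (k ℕ.+ p)) (a k)) where
  open Setoid S
  open SetoidReasoning S
  open import Data.Nat using (_+_; _*_; _/_)

  repeat : ∀ r q → a (r + q * p) ≈ a r
  repeat r zero    = reflexive (cong a (ℕₚ.+-identityʳ r))
  repeat r (suc q) = begin
    a (r + (p + q * p)) ≡⟨ cong a (≡.trans (cong (r +_) (ℕₚ.+-comm p (q * p))) (≡.sym (ℕₚ.+-assoc r (q * p) p))) ⟩
    a (r + q * p + p)   ≈⟨ shift (r + q * p) ⟩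
    a (r + q * p)       ≈⟨ repeat r q ⟩
    a r                 ∎

  returns⇔divides : (∀ j → 0 < j → j < p → ¬ a j ≈ a 0) → ∀ k → a k ≈ a 0 ⇔ p ∣ k
  returns⇔divides minimal k = mk⇔ returns⇒divides divides⇒returns
    where
    divides⇒returns : p ∣ k → a k ≈ a 0
    divides⇒returns (divides q ≡.refl) = repeat 0 q
    returns⇒divides : a k ≈ a 0 → p ∣ k
    returns⇒divides ak≈a0 with k % p ℕ.≟ 0
    ... | yes r≡0 = m%n≡0⇒n∣m k p r≡0
    ... | no  r≢0 = ⊥-elim (minimal (k % p) (ℕₚ.n≢0⇒n>0 r≢0) (m%n<n k p) (begin
      a (k % p)             ≈⟨ repeat (k % p) (k / p) ⟨
      a (k % p + k / p * p) ≡⟨ cong a (m≡m%n+[m/n]*n k p) ⟨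
      a k                   ≈⟨ ak≈a0 ⟩
      a 0                   ∎))

Least : ∀ {p} → Pred ℕ p → Set p
Least P = Σ ℕ λ l → P l × (∀ j → j < l → ¬ P j)

module _ {p} {P : Pred ℕ p} (P? : Decidable P) where

  scan : ∀ m → (∀ j → j < m → ¬ P j) ⊎ Least P
  scan zero = inj₁ (λ j ())
  scan (suc m) with scan m
  ... | inj₂ least = inj₂ least
  ... | inj₁ none with P? m
  ...   | yes pm  = inj₂ (m , pm , none)
  ...   | no  ¬pm = inj₁ below
    where
    below : ∀ j → j < suc m → ¬ P j
    below j j<1+m with j ℕ.≟ m
    ... | yes ≡.refl = ¬pm
    ... | no  j≢m    = none j (ℕₚ.≤∧≢⇒< (s≤s⁻¹ j<1+m) j≢m)

  least-witness : ∀ {m} → P m → Least P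
  least-witness {m} pm with scan (suc m)
  ... | inj₁ none  = ⊥-elim (none m ℕₚ.≤-refl pm)
  ... | inj₂ least = least

stabilizer : {A : Set} → DecidableEquality A → (h : A → A) (x : A) (m : ℕ) →
  iter (suc m) h x ≡ x → Σ ℕ λ q → ∀ k → iter k h x ≡ x ⇔ suc q ∣ k
stabilizer _≟ᴬ_ h x m returns
  with q , returns-q , earlier ← least-witness (λ j → iter (suc j) h x ≟ᴬ x) {m} returns =
  q , PeriodicSequence.returns⇔divides (≡.setoid _) (λ k → iter k h x) (suc q) shift minimal
  where
  shift : ∀ k → iter (k ℕ.+ suc q) h x ≡ iter k h x
  shift k = ≡.trans (iter-+ h k (suc q) x) (cong (iter k h) returns-q)
  minimal : ∀ j → 0 < j → j < suc q → ¬ iter j h x ≡ x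
  minimal (suc j) _ (s≤s j<q) = earlier j j<q

nonZero-factor : ∀ q p {n} .{{_ : NonZero n}} → q ℕ.* p ≡ n → NonZero p
nonZero-factor q zero    qp≡n = ⊥-elim (≢-nonZero⁻¹ _ (≡.trans (≡.sym qp≡n) (ℕₚ.*-zeroʳ q)))
nonZero-factor q (suc p) _    = _

module Sums {c ℓ} (S : Semiring c ℓ) where
  open Semiring S
  open import Algebra.Properties.Semiring.Sum S public
  open SetoidReasoning setoid

  select : ∀ {a} {A : Set a} → Dec A → Carrier → Carrier
  select d x = if does d then x else 0#

  select-yes : ∀ {a} {A : Set a} (d : Dec A) {x} → A → select d x ≈ x
  select-yes (yes _) _  = refl
  select-yes (no ¬a) a = ⊥-elim (¬a a)

  select-no : ∀ {a} {A : Set a} (d : Dec A) {x} → ¬ A → select d x ≈ 0#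
  select-no (yes a) ¬a = ⊥-elim (¬a a)
  select-no (no _)  _  = refl

  select-⇔ : ∀ {a b} {A : Set a} {B : Set b} (d : Dec A) (d′ : Dec B) {x} → A ⇔ B → select d x ≈ select d′ x
  select-⇔ (yes a) d′ A⇔B = sym (select-yes d′ (Equivalence.to A⇔B a))
  select-⇔ (no ¬a) d′ A⇔B = sym (select-no d′ (¬a ∘ Equivalence.from A⇔B))

  select-cong : ∀ {a} {A : Set a} (d : Dec A) {x y} → (A → x ≈ y) → select d x ≈ select d y
  select-cong (yes a) x≈y = x≈y a
  select-cong (no _)  _   = refl

  select-0# : ∀ {a} {A : Set a} (d : Dec A) → select d 0# ≈ 0#
  select-0# (yes _) = refl
  select-0# (no _)  = refl

  select-comm : ∀ {a b} {A : Set a} {B : Set b} (d : Dec A) (e : Dec B) x →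
    select d (select e x) ≈ select e (select d x)
  select-comm (yes _) e x = refl
  select-comm (no _)  e x = sym (select-0# e)

  select-*ˡ : ∀ {a} {A : Set a} (d : Dec A) x y → select d x * y ≈ select d (x * y)
  select-*ˡ (yes _) x y = refl
  select-*ˡ (no _)  x y = zeroˡ y

  select-sum : ∀ {a} {A : Set a} (d : Dec A) {m} (F : Vector Carrier m) →
    select d (sum F) ≈ ∑[ i < m ] select d (F i)
  select-sum (yes _)     F = refl
  select-sum (no _) {m}  F = sym (sum-replicate-zero m)

  Σ₁ : ℕ → (ℕ → Carrier) → Carrier
  Σ₁ m F = ∑[ i < m ] F (suc (toℕ i))

  Σ₁-cong : ∀ m {F G : ℕ → Carrier} → (∀ k → 1 ≤ k → k ≤ m → F k ≈ G k) → Σ₁ m F ≈ Σ₁ m G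
  Σ₁-cong m F≈G = sum-cong-≋ (λ i → F≈G (suc (toℕ i)) (s≤s z≤n) (FinP.toℕ<n i))

  Σ₁-+ : ∀ m (F G : ℕ → Carrier) → Σ₁ m (λ k → F k + G k) ≈ Σ₁ m F + Σ₁ m G
  Σ₁-+ m F G = ∑-distrib-+ {m} (λ i → F (suc (toℕ i))) (λ i → G (suc (toℕ i)))

  Σ₁-*ˡ : ∀ m x (F : ℕ → Carrier) → x * Σ₁ m F ≈ Σ₁ m (λ k → x * F k)
  Σ₁-*ˡ m x F = *-distribˡ-sum {m} x (λ i → F (suc (toℕ i)))

  Σ₁-zero : ∀ m {F : ℕ → Carrier} → (∀ k → 1 ≤ k → k ≤ m → F k ≈ 0#) → Σ₁ m F ≈ 0#
  Σ₁-zero m F≈0 = trans (Σ₁-cong m F≈0) (sum-replicate-zero m)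

  Σ₁-last : ∀ m (F : ℕ → Carrier) → Σ₁ (suc m) F ≈ Σ₁ m F + F (suc m)
  Σ₁-last m F = trans (sum-init-last {m} (λ i → F (suc (toℕ i))))
    (+-cong (reflexive (sum-cong-≗ {m} (λ i → cong (F ∘ suc) (FinP.toℕ-inject₁ i))))
            (reflexive (cong (F ∘ suc) (FinP.toℕ-fromℕ m))))

  Σ₁-split : ∀ a b (F : ℕ → Carrier) → Σ₁ (a ℕ.+ b) F ≈ Σ₁ a F + Σ₁ b (λ k → F (a ℕ.+ k))
  Σ₁-split zero    b F = sym (+-identityˡ _)
  Σ₁-split (suc a) b F = trans (+-congˡ (Σ₁-split a b (F ∘ suc))) (sym (+-assoc _ _ _))

  Σ₁-pick : ∀ m v c → 1 ≤ v → v ≤ m → Σ₁ m (λ e → select (v ℕ.≟ e) c) ≈ c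
  Σ₁-pick (suc m) 1             c _ _   = trans (+-congˡ (sum-replicate-zero m)) (+-identityʳ c)
  Σ₁-pick (suc m) (suc (suc v)) c _ v≤m =
    trans (+-identityˡ _) (Σ₁-pick m (suc v) c (s≤s z≤n) (s≤s⁻¹ v≤m))

  Σ₁-one-multiple : ∀ p .{{_ : NonZero p}} (F : ℕ → Carrier) →
    Σ₁ p (λ k → select (p ∣? k) (F k)) ≈ F p
  Σ₁-one-multiple (suc p) F = begin
    Σ₁ (suc p) G       ≈⟨ Σ₁-last p G ⟩
    Σ₁ p G + G (suc p) ≈⟨ +-cong (Σ₁-zero p below) (select-yes (suc p ∣? suc p) ∣-refl) ⟩
    0# + F (suc p)     ≈⟨ +-identityˡ _ ⟩
    F (suc p)          ∎
    where
    G : ℕ → Carrier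
    G k = select (suc p ∣? k) (F k)
    below : ∀ k → 1 ≤ k → k ≤ p → G k ≈ 0#
    below (suc k) _ k<p = select-no (suc p ∣? suc k) (λ p∣k → ℕₚ.1+n≰n (ℕₚ.≤-trans (∣⇒≤ p∣k) k<p))

  Σ₁-multiples : ∀ q p .{{_ : NonZero p}} (F : ℕ → Carrier) →
    Σ₁ (q ℕ.* p) (λ k → select (p ∣? k) (F k)) ≈ Σ₁ q (λ j → F (j ℕ.* p))
  Σ₁-multiples zero    p F = refl
  Σ₁-multiples (suc q) p F = begin
    Σ₁ (p ℕ.+ q ℕ.* p) G                        ≈⟨ Σ₁-split p (q ℕ.* p) G ⟩
    Σ₁ p G + Σ₁ (q ℕ.* p) (λ k → G (p ℕ.+ k))   ≈⟨ +-cong (Σ₁-one-multiple p F) shifted ⟩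
    F p + Σ₁ q (λ j → F (p ℕ.+ j ℕ.* p))         ≡⟨ cong (λ p′ → F p′ + Σ₁ q (λ j → F (p ℕ.+ j ℕ.* p))) (ℕₚ.+-identityʳ p) ⟨
    F (p ℕ.+ 0) + Σ₁ q (λ j → F (p ℕ.+ j ℕ.* p)) ∎
    where
    G : ℕ → Carrier
    G k = select (p ∣? k) (F k)
    shifted : Σ₁ (q ℕ.* p) (λ k → G (p ℕ.+ k)) ≈ Σ₁ q (λ j → F (p ℕ.+ j ℕ.* p))
    shifted = trans (Σ₁-cong (q ℕ.* p) (λ k _ _ → select-⇔ (p ∣? p ℕ.+ k) (p ∣? k) {F (p ℕ.+ k)}
                      (mk⇔ (λ p∣p+k → ∣m+n∣m⇒∣n p∣p+k ∣-refl) (∣m∣n⇒∣m+n ∣-refl))))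
                    (Σ₁-multiples q p (F ∘ (p ℕ.+_)))

module ℕ∑ = Sums ℕₚ.+-*-semiring

module Counting where
  open ℕ∑

  count : ∀ {N a} {P : Pred (Fin N) a} → Decidable P → ℕ
  count {N} P? = ∑[ x < N ] select (P? x) 1

  length-filter-tabulate : ∀ {A : Set} {a} {P : Pred A a} (P? : Decidable P) {N} (f : Fin N → A) →
    length (filter P? (tabulate f)) ≡ ∑[ i < N ] select (P? (f i)) 1
  length-filter-tabulate P? {zero}  f = ≡.refl
  length-filter-tabulate P? {suc N} f with P? (f Fin.zero)
  ... | yes _ = cong suc (length-filter-tabulate P? (λ i → f (Fin.suc i)))
  ... | no  _ = length-filter-tabulate P? (λ i → f (Fin.suc i))

  length-filter-allFin : ∀ {N a} {P : Pred (Fin N) a} (P? : Decidable P) →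
    length (filter P? (allFin N)) ≡ count P?
  length-filter-allFin P? = length-filter-tabulate P? (λ x → x)

  select-× : ∀ {a b} {A : Set a} {B : Set b} (d : Dec A) (e : Dec B) m →
    select (d ×-dec e) m ≡ select d (select e m)
  select-× (yes _) (yes _) m = ≡.refl
  select-× (yes _) (no _)  m = ≡.refl
  select-× (no _)  e       m = ≡.refl

  fixCount-by-period : ∀ {N} (Y : Subset N) (h : Fin N → Fin N) (per : Fin N → ℕ) k →
    (∀ x → x ∈ Y → h x ≡ x ⇔ per x ∣ k) →
    fixCount Y h ≡ ∑[ x < N ] select (x ∈? Y) (select (per x ∣? k) 1)
  fixCount-by-period {N} Y h per k fixed⇔ = ≡.trans (length-filter-allFin (λ x → (x ∈? Y) ×-dec (h x FinP.≟ x)))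
    (sum-cong-≗ {N} λ x → ≡.trans (select-× (x ∈? Y) (h x FinP.≟ x) 1) (by-membership x))
    where
    by-membership : ∀ x → select (x ∈? Y) (select (h x FinP.≟ x) 1) ≡ select (x ∈? Y) (select (per x ∣? k) 1)
    by-membership x with x ∈? Y
    ... | yes x∈Y = select-⇔ (h x FinP.≟ x) (per x ∣? k) (fixed⇔ x x∈Y)
    ... | no  _   = ≡.refl

  partition : ∀ {N} m (v G : Fin N → ℕ) → (∀ x → 1 ≤ v x) → (∀ x → v x ≤ m) →
    ∑[ x < N ] G x ≡ Σ₁ m (λ e → ∑[ x < N ] select (v x ℕ.≟ e) (G x))
  partition {N} m v G 1≤v v≤m = ≡.trans
    (sum-cong-≗ {N} (λ x → ≡.sym (Σ₁-pick m (v x) (G x) (1≤v x) (v≤m x))))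
    (∑-comm {N} {m} (λ x i → select (v x ℕ.≟ suc (toℕ i)) (G x)))

  ∣-sum : ∀ {d m} (F : Fin m → ℕ) → (∀ i → d ∣ F i) → d ∣ sum F
  ∣-sum {m = zero}  F d∣F = _ ∣0
  ∣-sum {m = suc m} F d∣F = ∣m∣n⇒∣m+n (d∣F Fin.zero) (∣-sum (λ i → F (Fin.suc i)) (λ i → d∣F (Fin.suc i)))

  period-class? : ∀ {N a} {Y : Pred (Fin N) a} → Decidable Y → (per : Fin N → ℕ) → ∀ d →
    Decidable (λ x → Y x × per x ≡ d)
  period-class? Y? per d x = Y? x ×-dec (per x ℕ.≟ d)

open Counting

downward-induction : ∀ {p} (P : ℕ → Set p) n → (∀ d → (∀ e → d < e → e ≤ n → P e) → P d) → ∀ d → P d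
downward-induction P n step d = go n d (ℕₚ.m≤m+n n d)
  where
  go : ∀ m d → n ≤ m ℕ.+ d → P d
  go zero    d n≤d   = step d (λ e d<e e≤n → ⊥-elim (ℕₚ.<⇒≱ d<e (ℕₚ.≤-trans e≤n n≤d)))
  go (suc m) d n≤m+d = step d (λ e d<e e≤n → go m e (ℕₚ.≤-trans n≤m+d
    (ℕₚ.≤-trans (ℕₚ.≤-reflexive (≡.sym (ℕₚ.+-suc m d))) (ℕₚ.+-monoʳ-≤ m d<e))))


-- Grouping the points by period, the transform at t = n / d is the
-- total cofactor of the points whose period is a multiple of d; downward induction on d
-- peels off the contributions of the proper multiples.
module PeriodClasses (n : ℕ) .{{_ : NonZero n}} {N a} {Y : Pred (Fin N) a} (Y? : Decidable Y)
  (per cof : Fin N → ℕ) (cof·per≡n : ∀ x → cof x ℕ.* per x ≡ n)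
  (transform-divisible : ∀ t → n ∣ ℕ∑.sum (λ x → ℕ∑.select (Y? x) (ℕ∑.select (n ∣? t ℕ.* per x) (cof x))))
  where
  open ℕ∑
  open import Data.Nat using (_+_; _*_; _≟_)
  open ≡.≡-Reasoning

  class-size : ℕ → ℕ
  class-size d = count (period-class? Y? per d)

  class-mass : ℕ → ℕ
  class-mass d = ∑[ x < N ] select (Y? x) (select (per x ≟ d) (cof x))

  per∣n : ∀ x → per x ∣ n
  per∣n x = divides (cof x) (≡.sym (cof·per≡n x))

  1≤per : ∀ x → 1 ≤ per x
  1≤per x = >-nonZero⁻¹ (per x) {{nonZero-factor (cof x) (per x) (cof·per≡n x)}}

  empty-class : ∀ d → ¬ d ∣ n → (F : Fin N → ℕ) → ∑[ x < N ] select (Y? x) (select (per x ≟ d) (F x)) ≡ 0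
  empty-class d d∤n F = ≡.trans (sum-cong-≗ {N} none) (sum-replicate-zero N)
    where
    none : ∀ x → select (Y? x) (select (per x ≟ d) (F x)) ≡ 0
    none x = ≡.trans (cong (select (Y? x)) (select-no (per x ≟ d) λ p≡d → d∤n (≡.subst (_∣ n) p≡d (per∣n x))))
                     (select-0# (Y? x))

  strict-multiple? : ∀ d e → Dec (d ∣ e × ¬ d ≡ e)
  strict-multiple? d e = (d ∣? e) ×-dec ¬? (d ≟ e)

  proper-mass : ℕ → Fin N → ℕ
  proper-mass d x = select (Y? x) (select (strict-multiple? d (per x)) (cof x))

  multiple-split : ∀ d x → select (Y? x) (select (d ∣? per x) (cof x)) ≡
                           select (Y? x) (select (per x ≟ d) (cof x)) + proper-mass d x
  multiple-split d x with Y? x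
  ... | no  _ = ≡.refl
  ... | yes _ with per x ≟ d
  ...   | yes p≡d = begin
    select (d ∣? per x) (cof x)                                              ≡⟨ select-yes (d ∣? per x) d∣p ⟩
    cof x                                                                    ≡⟨ ℕₚ.+-identityʳ _ ⟨
    cof x + 0                                                                ≡⟨ cong₂ _+_ (select-yes (per x ≟ d) p≡d) not-proper ⟨
    select (per x ≟ d) (cof x) + select (strict-multiple? d (per x)) (cof x) ∎
    where
    d∣p : d ∣ per x
    d∣p = ≡.subst (d ∣_) (≡.sym p≡d) ∣-refl
    not-proper : select (strict-multiple? d (per x)) (cof x) ≡ 0
    not-proper = select-no (strict-multiple? d (per x)) (λ (_ , d≢p) → d≢p (≡.sym p≡d))
  ...   | no  p≢d = ≡.trans
    (select-⇔ (d ∣? per x) (strict-multiple? d (per x)) (mk⇔ (λ d∣p → d∣p , λ d≡p → p≢d (≡.sym d≡p)) proj₁))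
    (cong (_+ select (strict-multiple? d (per x)) (cof x)) (≡.sym (select-no (per x ≟ d) p≢d)))

  proper-mass-by-period : ∀ d e →
    ∑[ x < N ] select (per x ≟ e) (proper-mass d x) ≡ select (strict-multiple? d e) (class-mass e)
  proper-mass-by-period d e = ≡.trans (sum-cong-≗ {N} term) (≡.sym (select-sum (strict-multiple? d e) {N} _))
    where
    term : ∀ x → select (per x ≟ e) (proper-mass d x) ≡
                 select (strict-multiple? d e) (select (Y? x) (select (per x ≟ e) (cof x)))
    term x with per x ≟ e
    ... | yes p≡e = begin
      select (per x ≟ e) (proper-mass d x)
        ≡⟨ select-yes (per x ≟ e) p≡e ⟩
      select (Y? x) (select (strict-multiple? d (per x)) (cof x))
        ≡⟨ select-comm (Y? x) (strict-multiple? d (per x)) (cof x) ⟩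
      select (strict-multiple? d (per x)) (select (Y? x) (cof x))
        ≡⟨ cong (λ c → select (strict-multiple? d c) (select (Y? x) (cof x))) p≡e ⟩
      select (strict-multiple? d e) (select (Y? x) (cof x))
        ≡⟨ cong (λ c → select (strict-multiple? d e) (select (Y? x) c)) (select-yes (per x ≟ e) p≡e) ⟨
      select (strict-multiple? d e) (select (Y? x) (select (per x ≟ e) (cof x))) ∎
    ... | no  p≢e = begin
      select (per x ≟ e) (proper-mass d x)
        ≡⟨ select-no (per x ≟ e) p≢e ⟩
      0
        ≡⟨ ≡.trans (cong (select (strict-multiple? d e)) (select-0# (Y? x))) (select-0# (strict-multiple? d e)) ⟨
      select (strict-multiple? d e) (select (Y? x) 0)
        ≡⟨ cong (λ c → select (strict-multiple? d e) (select (Y? x) c)) (select-no (per x ≟ e) p≢e) ⟨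
      select (strict-multiple? d e) (select (Y? x) (select (per x ≟ e) (cof x))) ∎

  multiples-mass : ∀ d →
    ∑[ x < N ] select (Y? x) (select (d ∣? per x) (cof x)) ≡
    class-mass d + Σ₁ n (λ e → select (strict-multiple? d e) (class-mass e))
  multiples-mass d = begin
    ∑[ x < N ] select (Y? x) (select (d ∣? per x) (cof x))
      ≡⟨ sum-cong-≗ {N} (multiple-split d) ⟩
    ∑[ x < N ] (select (Y? x) (select (per x ≟ d) (cof x)) + proper-mass d x)
      ≡⟨ ∑-distrib-+ {N} (λ x → select (Y? x) (select (per x ≟ d) (cof x))) (proper-mass d) ⟩
    class-mass d + ∑[ x < N ] proper-mass d x
      ≡⟨ cong (class-mass d +_) (partition n per (proper-mass d) 1≤per (λ x → ∣⇒≤ (per∣n x))) ⟩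
    class-mass d + Σ₁ n (λ e → ∑[ x < N ] select (per x ≟ e) (proper-mass d x))
      ≡⟨ cong (class-mass d +_) (Σ₁-cong n (λ e _ _ → proper-mass-by-period d e)) ⟩
    class-mass d + Σ₁ n (λ e → select (strict-multiple? d e) (class-mass e)) ∎

  class-mass-divisible : ∀ d → n ∣ class-mass d
  class-mass-divisible = downward-induction (λ d → n ∣ class-mass d) n step
    where
    step : ∀ d → (∀ e → d < e → e ≤ n → n ∣ class-mass e) → n ∣ class-mass d
    step d _ with d ∣? n
    ... | no d∤n = ≡.subst (n ∣_) (≡.sym (empty-class d d∤n cof)) (n ∣0)
    step d larger | yes (divides r n≡rd) = ∣m+n∣m⇒∣n (≡.subst (n ∣_) (ℕₚ.+-comm (class-mass d) _) total) rest-divisible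
      where
      instance
        r≢0 : NonZero r
        r≢0 = nonZero-factor d r (≡.trans (ℕₚ.*-comm d r) (≡.sym n≡rd))

      -- At t = n / d the transform picks out the points whose period is a multiple of d.
      at-cofactor : ∀ x → select (Y? x) (select (n ∣? r * per x) (cof x)) ≡
                          select (Y? x) (select (d ∣? per x) (cof x))
      at-cofactor x = cong (select (Y? x)) (select-⇔ (n ∣? r * per x) (d ∣? per x) (mk⇔
        (λ n∣rp → *-cancelˡ-∣ r (≡.subst (_∣ r * per x) n≡rd n∣rp))
        (λ d∣p → ≡.subst (_∣ r * per x) (≡.sym n≡rd) (*-monoʳ-∣ r d∣p))))

      total : n ∣ class-mass d + Σ₁ n (λ e → select (strict-multiple? d e) (class-mass e))
      total = ≡.subst (n ∣_) (≡.trans (sum-cong-≗ {N} at-cofactor) (multiples-mass d)) (transform-divisible r)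

      rest-divisible : n ∣ Σ₁ n (λ e → select (strict-multiple? d e) (class-mass e))
      rest-divisible = ∣-sum {m = n} _ (λ i → term (suc (toℕ i)) (s≤s z≤n) (FinP.toℕ<n i))
        where
        term : ∀ e → 1 ≤ e → e ≤ n → n ∣ select (strict-multiple? d e) (class-mass e)
        term e 1≤e e≤n with strict-multiple? d e
        ... | yes (d∣e , d≢e) = ≡.subst (n ∣_) (≡.sym (select-yes (strict-multiple? d e) (d∣e , d≢e)))
                                  (larger e (ℕₚ.≤∧≢⇒< (∣⇒≤ {{>-nonZero 1≤e}} d∣e) d≢e) e≤n)
        ... | no  ¬strict     = ≡.subst (n ∣_) (≡.sym (select-no (strict-multiple? d e) ¬strict)) (n ∣0)

  class-size-divisible : ∀ d → d ∣ class-size d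
  class-size-divisible d with d ∣? n
  ... | no d∤n = ≡.subst (d ∣_) (≡.sym (≡.trans (sum-cong-≗ {N} nested) (empty-class d d∤n (λ _ → 1)))) (d ∣0)
    where
    nested : ∀ x → select (period-class? Y? per d x) 1 ≡ select (Y? x) (select (per x ≟ d) 1)
    nested x = select-× (Y? x) (per x ≟ d) 1
  ... | yes (divides r n≡rd) =
    *-cancelˡ-∣ r (≡.subst₂ _∣_ n≡rd (≡.trans mass≡size·r (ℕₚ.*-comm _ r)) (class-mass-divisible d))
    where
    instance
      r≢0 : NonZero r
      r≢0 = nonZero-factor d r (≡.trans (ℕₚ.*-comm d r) (≡.sym n≡rd))
      d≢0 : NonZero d
      d≢0 = nonZero-factor r d (≡.sym n≡rd)

    cofactor : ∀ x → per x ≡ d → cof x ≡ r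
    cofactor x p≡d = ℕₚ.*-cancelʳ-≡ (cof x) r d
      (≡.trans (cong (cof x *_) (≡.sym p≡d)) (≡.trans (cof·per≡n x) n≡rd))

    mass≡size·r : class-mass d ≡ class-size d * r
    mass≡size·r = ≡.trans (sum-cong-≗ {N} pointwise) (≡.sym (*-distribʳ-sum {N} r _))
      where
      pointwise : ∀ x → select (Y? x) (select (per x ≟ d) (cof x)) ≡ select (period-class? Y? per d x) 1 * r
      pointwise x = ≡.sym (≡.trans (cong (_* r) (select-× (Y? x) (per x ≟ d) 1))
                          (≡.trans (select-*ˡ (Y? x) _ r) (select-cong (Y? x) λ _ →
        ≡.trans (select-*ˡ (per x ≟ d) 1 r)
                (select-cong (per x ≟ d) λ p≡d → ≡.trans (ℕₚ.*-identityˡ r) (≡.sym (cofactor x p≡d))))))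

module RingFacts {c ℓ : Level} (R : CommutativeRing c ℓ) where
  open CommutativeRing R
  open Sums semiring public
  open import Algebra.Definitions.RawSemiring (Semiring.rawSemiring semiring) public
    using (_^_) renaming (_×_ to _×ᴿ_)
  open import Algebra.Properties.Semiring.Exp semiring using (^-homo-*; ^-assocʳ)
  open import Algebra.Properties.CommutativeSemiring.Exp commutativeSemiring using (^-distrib-*)
  open import Algebra.Properties.Semiring.Mult semiring using (×1-homo-*)
  open import Algebra.Properties.Monoid.Mult +-monoid using (×-homo-+)
  open import Algebra.Properties.Ring ring using (+-cancelˡ; +-cancelʳ; x∙y⁻¹≈ε⇒x≈y; -1*x≈-x)
  open SetoidReasoning setoid

  ι : ℕ → Carrier
  ι m = m ×ᴿ 1#

  ℕ→R≡ι : ∀ m → ℕ→R R m ≡ ι m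
  ℕ→R≡ι zero    = ≡.refl
  ℕ→R≡ι (suc m) = cong (1# +_) (ℕ→R≡ι m)

  pow≡^ : ∀ x m → pow R x m ≡ x ^ m
  pow≡^ x zero    = ≡.refl
  pow≡^ x (suc m) = cong (x *_) (pow≡^ x m)

  ι-+ : ∀ a b → ι (a ℕ.+ b) ≈ ι a + ι b
  ι-+ a b = ×-homo-+ 1# a b

  ι-* : ∀ a b → ι (a ℕ.* b) ≈ ι a * ι b
  ι-* = ×1-homo-*

  ι-select : ∀ {a} {A : Set a} (d : Dec A) m → ι (ℕ∑.select d m) ≈ select d (ι m)
  ι-select (yes _) m = refl
  ι-select (no _)  m = refl

  ι-sum : ∀ {m} (F : Fin m → ℕ) → ι (ℕ∑.sum F) ≈ ∑[ i < m ] ι (F i)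
  ι-sum {zero}  F = refl
  ι-sum {suc m} F = trans (ι-+ (F Fin.zero) _) (+-congˡ (ι-sum (F ∘ Fin.suc)))

  ι-select₂ : ∀ {a b} {A : Set a} {B : Set b} (d : Dec A) (e : Dec B) m →
    ι (ℕ∑.select d (ℕ∑.select e m)) ≈ select d (select e (ι m))
  ι-select₂ (yes _) e m = ι-select e m
  ι-select₂ (no _)  e m = refl

  ι-scale : ∀ {a} {A : Set a} c (d : Dec A) m → ι c * select d (ι m) ≈ ι (ℕ∑.select d c ℕ.* m)
  ι-scale c (yes _) m = sym (ι-* c m)
  ι-scale c (no _)  m = zeroʳ (ι c)

  module _ (domain : IsChar0Domain R) where
    open IsChar0Domain domain

    ι-injective : ∀ a b → ι a ≈ ι b → a ≡ b
    ι-injective zero    zero    _ = ≡.refl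
    ι-injective zero    (suc b) e = ⊥-elim (char0 b (≡.subst (_≈ 0#) (≡.sym (ℕ→R≡ι (suc b))) (sym e)))
    ι-injective (suc a) zero    e = ⊥-elim (char0 a (≡.subst (_≈ 0#) (≡.sym (ℕ→R≡ι (suc a))) e))
    ι-injective (suc a) (suc b) e = cong suc (ι-injective a b (+-cancelˡ 1# (ι a) (ι b) e))

    -- In a domain, the powers v, v², …, vᵐ of an m-th root of unity v ≠ 1 sum to zero:
    -- v times the sum is the sum again, so (v - 1) kills it.
    geometric-sum-zero : ∀ m v → v ^ m ≈ 1# → ¬ v ≈ 1# → Σ₁ m (v ^_) ≈ 0#
    geometric-sum-zero m v vᵐ≈1 v≉1 with noZeroDiv (v - 1#) H v-1·H≈0
      where
      H : Carrier
      H = Σ₁ m (v ^_)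
      vH≈H : v * H ≈ H
      vH≈H = +-cancelʳ (v * 1#) (v * H) H (begin
        v * H + v * 1#                ≈⟨ +-comm _ _ ⟩
        v ^ 1 + v * H                 ≈⟨ +-congˡ (Σ₁-*ˡ m v (v ^_)) ⟩
        Σ₁ (suc m) (v ^_)             ≈⟨ Σ₁-last m (v ^_) ⟩
        H + v * v ^ m                 ≈⟨ +-congˡ (*-congˡ (trans vᵐ≈1 (sym (*-identityˡ 1#)))) ⟩
        H + v * (1# * 1#)             ≈⟨ +-congˡ (*-congˡ (*-identityˡ 1#)) ⟩
        H + v * 1#                    ∎)
      v-1·H≈0 : (v - 1#) * H ≈ 0#
      v-1·H≈0 = begin
        (v - 1#) * H     ≈⟨ distribʳ H v (- 1#) ⟩
        v * H + - 1# * H ≈⟨ +-cong vH≈H (-1*x≈-x H) ⟩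
        H - H            ≈⟨ -‿inverseʳ H ⟩
        0#               ∎
    ... | inj₁ v-1≈0 = ⊥-elim (v≉1 (x∙y⁻¹≈ε⇒x≈y v 1# v-1≈0))
    ... | inj₂ H≈0   = H≈0

    module PrimitiveRoot (n : ℕ) .{{_ : NonZero n}} (ω : Carrier)
      (ω-primitive : IsPrimitiveRoot R n ω) where
      open IsPrimitiveRoot ω-primitive
      open Equivalence

      ωⁿ≈1 : ω ^ n ≈ 1#
      ωⁿ≈1 = ≡.subst (_≈ 1#) (pow≡^ ω n) rootOfUnity

      ω^e≈1⇔n∣e : ∀ e → ω ^ e ≈ 1# ⇔ n ∣ e
      ω^e≈1⇔n∣e = PeriodicSequence.returns⇔divides setoid (ω ^_) n shift minimal
        where
        shift : ∀ k → ω ^ (k ℕ.+ n) ≈ ω ^ k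
        shift k = begin
          ω ^ (k ℕ.+ n) ≈⟨ ^-homo-* ω k n ⟩
          ω ^ k * ω ^ n ≈⟨ *-congˡ ωⁿ≈1 ⟩
          ω ^ k * 1#    ≈⟨ *-identityʳ _ ⟩
          ω ^ k         ∎
        minimal : ∀ j → 0 < j → j < n → ¬ ω ^ j ≈ 1#
        minimal j 0<j j<n = isPrimitive j 0<j j<n ∘ ≡.subst (_≈ 1#) (≡.sym (pow≡^ ω j))

      root-sum : ∀ e m → n ∣ e ℕ.* m → Σ₁ m ((ω ^ e) ^_) ≈ select (n ∣? e) (ι m)
      root-sum e m n∣em with n ∣? e
      ... | yes n∣e = trans (Σ₁-cong m (λ j _ _ → ω^ej≈1 j)) (sum-replicate m)
        where
        ω^ej≈1 : ∀ j → (ω ^ e) ^ j ≈ 1#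
        ω^ej≈1 j = trans (^-assocʳ ω e j) (from (ω^e≈1⇔n∣e (e ℕ.* j)) (∣m⇒∣m*n j n∣e))
      ... | no  n∤e = geometric-sum-zero m (ω ^ e)
        (trans (^-assocʳ ω e m) (from (ω^e≈1⇔n∣e (e ℕ.* m)) n∣em))
        (n∤e ∘ to (ω^e≈1⇔n∣e e))

      -- The total coefficient of f in the degrees j with n ∣ t + j.
      residue-mass : ℕ → Poly → ℕ
      residue-mass t []       = 0
      residue-mass t (c ∷ cs) = ℕ∑.select (n ∣? t) c ℕ.+ residue-mass (suc t) cs

      horner-step : ∀ c cs t k → evalR R (c ∷ cs) (ω ^ k) * (ω ^ t) ^ k ≈
                                 ι c * (ω ^ t) ^ k + evalR R cs (ω ^ k) * (ω ^ suc t) ^ k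
      horner-step c cs t k = begin
        (ℕ→R R c + ω ^ k * E) * u ^ k         ≈⟨ distribʳ _ _ _ ⟩
        ℕ→R R c * u ^ k + (ω ^ k * E) * u ^ k ≡⟨ cong (λ a → a * u ^ k + (ω ^ k * E) * u ^ k) (ℕ→R≡ι c) ⟩
        ι c * u ^ k + (ω ^ k * E) * u ^ k     ≈⟨ +-congˡ (*-congʳ (*-comm _ _)) ⟩
        ι c * u ^ k + (E * ω ^ k) * u ^ k     ≈⟨ +-congˡ (*-assoc _ _ _) ⟩
        ι c * u ^ k + E * (ω ^ k * u ^ k)     ≈⟨ +-congˡ (*-congˡ (^-distrib-* ω u k)) ⟨
        ι c * u ^ k + E * (ω * u) ^ k         ∎
        where
        u E : Carrier
        u = ω ^ t
        E = evalR R cs (ω ^ k)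

      polynomial-side : ∀ f t →
        Σ₁ n (λ k → evalR R f (ω ^ k) * (ω ^ t) ^ k) ≈ ι (residue-mass t f ℕ.* n)
      polynomial-side []       t = Σ₁-zero n (λ k _ _ → zeroˡ ((ω ^ t) ^ k))
      polynomial-side (c ∷ cs) t = begin
        Σ₁ n (λ k → evalR R (c ∷ cs) (ω ^ k) * u ^ k)
          ≈⟨ Σ₁-cong n {λ k → evalR R (c ∷ cs) (ω ^ k) * u ^ k} (λ k _ _ → horner-step c cs t k) ⟩
        Σ₁ n (λ k → ι c * u ^ k + evalR R cs (ω ^ k) * (ω ^ suc t) ^ k)
          ≈⟨ Σ₁-+ n (λ k → ι c * u ^ k) (λ k → evalR R cs (ω ^ k) * (ω ^ suc t) ^ k) ⟩
        Σ₁ n (λ k → ι c * u ^ k) + Σ₁ n (λ k → evalR R cs (ω ^ k) * (ω ^ suc t) ^ k)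
          ≈⟨ +-cong (sym (Σ₁-*ˡ n (ι c) (u ^_))) (polynomial-side cs (suc t)) ⟩
        ι c * Σ₁ n (u ^_) + ι (M′ ℕ.* n)
          ≈⟨ +-congʳ (*-congˡ (root-sum t n (∣n⇒∣m*n t ∣-refl))) ⟩
        ι c * select (n ∣? t) (ι n) + ι (M′ ℕ.* n)
          ≈⟨ +-congʳ (ι-scale c (n ∣? t) n) ⟩
        ι (s ℕ.* n) + ι (M′ ℕ.* n)
          ≈⟨ ι-+ (s ℕ.* n) (M′ ℕ.* n) ⟨
        ι (s ℕ.* n ℕ.+ M′ ℕ.* n)
          ≡⟨ cong ι (ℕₚ.*-distribʳ-+ n s M′) ⟨
        ι ((s ℕ.+ M′) ℕ.* n) ∎
        where
        u : Carrier
        u = ω ^ t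
        s M′ : ℕ
        s  = ℕ∑.select (n ∣? t) c
        M′ = residue-mass (suc t) cs

      periodic-point-sum : ∀ t p q → q ℕ.* p ≡ n →
        Σ₁ n (λ k → select (p ∣? k) ((ω ^ t) ^ k)) ≈ select (n ∣? t ℕ.* p) (ι q)
      periodic-point-sum t p q qp≡n = begin
        Σ₁ n (λ k → select (p ∣? k) ((ω ^ t) ^ k))
          ≡⟨ cong (λ m → Σ₁ m (λ k → select (p ∣? k) ((ω ^ t) ^ k))) qp≡n ⟨
        Σ₁ (q ℕ.* p) (λ k → select (p ∣? k) ((ω ^ t) ^ k))
          ≈⟨ Σ₁-multiples q p {{nonZero-factor q p qp≡n}} ((ω ^ t) ^_) ⟩
        Σ₁ q (λ j → (ω ^ t) ^ (j ℕ.* p))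
          ≈⟨ Σ₁-cong q (λ j _ _ → regroup j) ⟩
        Σ₁ q ((ω ^ (t ℕ.* p)) ^_)
          ≈⟨ root-sum (t ℕ.* p) q (≡.subst (n ∣_) tn≡tpq (∣n⇒∣m*n t ∣-refl)) ⟩
        select (n ∣? t ℕ.* p) (ι q) ∎
        where
        regroup : ∀ j → (ω ^ t) ^ (j ℕ.* p) ≈ (ω ^ (t ℕ.* p)) ^ j
        regroup j = begin
          (ω ^ t) ^ (j ℕ.* p)   ≈⟨ ^-assocʳ ω t (j ℕ.* p) ⟩
          ω ^ (t ℕ.* (j ℕ.* p)) ≡⟨ cong (ω ^_) (≡.trans (cong (t ℕ.*_) (ℕₚ.*-comm j p)) (≡.sym (ℕₚ.*-assoc t p j))) ⟩
          ω ^ (t ℕ.* p ℕ.* j)   ≈⟨ ^-assocʳ ω (t ℕ.* p) j ⟨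
          (ω ^ (t ℕ.* p)) ^ j   ∎
        tn≡tpq : t ℕ.* n ≡ t ℕ.* p ℕ.* q
        tn≡tpq = ≡.trans (cong (t ℕ.*_) (≡.trans (≡.sym qp≡n) (ℕₚ.*-comm q p))) (≡.sym (ℕₚ.*-assoc t p q))

      fixed-point-transform : ∀ {N} {a} {Y : Pred (Fin N) a} (Y? : Decidable Y) (per cof : Fin N → ℕ) →
        (∀ x → cof x ℕ.* per x ≡ n) → ∀ t →
        Σ₁ n (λ k → ι (ℕ∑.sum (λ x → ℕ∑.select (Y? x) (ℕ∑.select (per x ∣? k) 1))) * (ω ^ t) ^ k)
          ≈ ι (ℕ∑.sum (λ x → ℕ∑.select (Y? x) (ℕ∑.select (n ∣? t ℕ.* per x) (cof x))))
      fixed-point-transform {N} Y? per cof cof·per≡n t = begin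
        Σ₁ n (λ k → ι (ℕ∑.sum (λ x → ℕ∑.select (Y? x) (ℕ∑.select (per x ∣? k) 1))) * u ^ k)
          ≈⟨ Σ₁-cong n (λ k _ _ → expand k) ⟩
        Σ₁ n (λ k → ∑[ x < N ] select (Y? x) (select (per x ∣? k) (u ^ k)))
          ≈⟨ ∑-comm {n} {N} (λ i x → select (Y? x) (select (per x ∣? suc (toℕ i)) (u ^ suc (toℕ i)))) ⟩
        ∑[ x < N ] Σ₁ n (λ k → select (Y? x) (select (per x ∣? k) (u ^ k)))
          ≈⟨ sum-cong-≋ {N} (λ x → sym (select-sum (Y? x) {n} (λ i → select (per x ∣? suc (toℕ i)) (u ^ suc (toℕ i))))) ⟩
        ∑[ x < N ] select (Y? x) (Σ₁ n (λ k → select (per x ∣? k) (u ^ k)))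
          ≈⟨ sum-cong-≋ {N} (λ x → select-cong (Y? x) λ _ → periodic-point-sum t (per x) (cof x) (cof·per≡n x)) ⟩
        ∑[ x < N ] select (Y? x) (select (n ∣? t ℕ.* per x) (ι (cof x)))
          ≈⟨ trans (ι-sum {N} _) (sum-cong-≋ {N} (λ x → ι-select₂ (Y? x) (n ∣? t ℕ.* per x) (cof x))) ⟨
        ι (ℕ∑.sum (λ x → ℕ∑.select (Y? x) (ℕ∑.select (n ∣? t ℕ.* per x) (cof x)))) ∎
        where
        u : Carrier
        u = ω ^ t
        expand : ∀ k → ι (ℕ∑.sum (λ x → ℕ∑.select (Y? x) (ℕ∑.select (per x ∣? k) 1))) * u ^ k
                       ≈ ∑[ x < N ] select (Y? x) (select (per x ∣? k) (u ^ k))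
        expand k = begin
          ι (ℕ∑.sum (λ x → ℕ∑.select (Y? x) (ℕ∑.select (per x ∣? k) 1))) * u ^ k
            ≈⟨ *-congʳ (trans (ι-sum {N} _) (sum-cong-≋ {N} (λ x → trans (ι-select₂ (Y? x) (per x ∣? k) 1)
                 (select-cong (Y? x) λ _ → select-cong (per x ∣? k) λ _ → +-identityʳ 1#)))) ⟩
          (∑[ x < N ] select (Y? x) (select (per x ∣? k) 1#)) * u ^ k
            ≈⟨ *-distribʳ-sum {N} (u ^ k) _ ⟩
          ∑[ x < N ] (select (Y? x) (select (per x ∣? k) 1#) * u ^ k)
            ≈⟨ sum-cong-≋ {N} (λ x → trans (select-*ˡ (Y? x) _ _) (select-cong (Y? x) λ _ →
                 trans (select-*ˡ (per x ∣? k) _ _) (select-cong (per x ∣? k) λ _ → *-identityˡ _))) ⟩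
          ∑[ x < N ] select (Y? x) (select (per x ∣? k) (u ^ k)) ∎

      -- Evaluating the transform
      -- Σ_k f(ωᵏ) (ωᵗ)ᵏ in the two ways above shows that ∑_{x ∈ Y} cof x · [n ∣ t · per x]
      -- is n times a residue mass of f, hence a multiple of n.
      transform-divisible : ∀ f {N} (Y : Subset N) (h : Fin N → Fin N) (per cof : Fin N → ℕ) →
        (∀ x → cof x ℕ.* per x ≡ n) → (∀ x → x ∈ Y → ∀ k → iter k h x ≡ x ⇔ per x ∣ k) →
        (∀ k → 1 ≤ k → k ≤ n → evalR R f (pow R ω k) ≈ ℕ→R R (fixCount Y (iter k h))) →
        ∀ t → n ∣ ℕ∑.sum (λ x → ℕ∑.select (x ∈? Y) (ℕ∑.select (n ∣? t ℕ.* per x) (cof x)))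
      transform-divisible f Y h per cof cof·per≡n returns⇔ sieving t =
        divides (residue-mass t f) (≡.sym (ι-injective _ _ (begin
          ι (residue-mass t f ℕ.* n)
            ≈⟨ polynomial-side f t ⟨
          Σ₁ n (λ k → evalR R f (ω ^ k) * (ω ^ t) ^ k)
            ≈⟨ Σ₁-cong n (λ k 1≤k k≤n → *-congʳ {(ω ^ t) ^ k} (counts k 1≤k k≤n)) ⟩
          Σ₁ n (λ k → ι (fixed k) * (ω ^ t) ^ k)
            ≈⟨ fixed-point-transform (_∈? Y) per cof cof·per≡n t ⟩
          ι (ℕ∑.sum (λ x → ℕ∑.select (x ∈? Y) (ℕ∑.select (n ∣? t ℕ.* per x) (cof x)))) ∎)))
        where
        fixed : ℕ → ℕ
        fixed k = ℕ∑.sum (λ x → ℕ∑.select (x ∈? Y) (ℕ∑.select (per x ∣? k) 1))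
        counts : ∀ k → 1 ≤ k → k ≤ n → evalR R f (ω ^ k) ≈ ι (fixed k)
        counts k 1≤k k≤n = ≡.subst₂ (λ a b → evalR R f a ≈ b) (pow≡^ ω k)
          (≡.trans (ℕ→R≡ι (fixCount Y (iter k h)))
                   (cong ι (fixCount-by-period Y (iter k h) per k (λ x x∈Y → returns⇔ x x∈Y k))))
          (sieving k 1≤k k≤n)

module Rotation (p : ℕ) .{{_ : NonZero p}} where
  open ≡.≡-Reasoning

  rotate : Fin p → Fin p
  rotate r = suc (toℕ r) mod p

  suc-% : ∀ a → suc (a % p) % p ≡ suc a % p
  suc-% a = begin
    (1 ℕ.+ a % p) % p         ≡⟨ %-distribˡ-+ 1 (a % p) p ⟩
    (1 % p ℕ.+ a % p % p) % p ≡⟨ cong (λ b → (1 % p ℕ.+ b) % p) (m%n%n≡m%n a p) ⟩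
    (1 % p ℕ.+ a % p) % p     ≡⟨ %-distribˡ-+ 1 a p ⟨
    (1 ℕ.+ a) % p             ∎

  toℕ-rotate^ : ∀ k r → toℕ (iter k rotate r) ≡ (toℕ r ℕ.+ k) % p
  toℕ-rotate^ zero    r = ≡.sym (≡.trans (cong (_% p) (ℕₚ.+-identityʳ (toℕ r))) (m<n⇒m%n≡m (FinP.toℕ<n r)))
  toℕ-rotate^ (suc k) r = begin
    toℕ (rotate (iter k rotate r))   ≡⟨ FinP.toℕ-fromℕ< _ ⟩
    suc (toℕ (iter k rotate r)) % p  ≡⟨ cong (λ a → suc a % p) (toℕ-rotate^ k r) ⟩
    suc ((toℕ r ℕ.+ k) % p) % p      ≡⟨ suc-% (toℕ r ℕ.+ k) ⟩
    suc (toℕ r ℕ.+ k) % p            ≡⟨ cong (_% p) (ℕₚ.+-suc (toℕ r) k) ⟨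
    (toℕ r ℕ.+ suc k) % p            ∎

  rotate-returns⇔ : ∀ k r → iter k rotate r ≡ r ⇔ p ∣ k
  rotate-returns⇔ k r = mk⇔ returns⇒divides divides⇒returns
    where
    returns⇒divides : iter k rotate r ≡ r → p ∣ k
    returns⇒divides returns = divides ((toℕ r ℕ.+ k) ℕ./ p) (ℕₚ.+-cancelˡ-≡ (toℕ r) _ _ (begin
      toℕ r ℕ.+ k                                      ≡⟨ m≡m%n+[m/n]*n (toℕ r ℕ.+ k) p ⟩
      (toℕ r ℕ.+ k) % p ℕ.+ (toℕ r ℕ.+ k) ℕ./ p ℕ.* p  ≡⟨ cong (ℕ._+ (toℕ r ℕ.+ k) ℕ./ p ℕ.* p) (≡.trans (≡.sym (toℕ-rotate^ k r)) (cong toℕ returns)) ⟩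
      toℕ r ℕ.+ (toℕ r ℕ.+ k) ℕ./ p ℕ.* p              ∎))
    divides⇒returns : p ∣ k → iter k rotate r ≡ r
    divides⇒returns p∣k = FinP.toℕ-injective (begin
      toℕ (iter k rotate r)  ≡⟨ toℕ-rotate^ k r ⟩
      (toℕ r ℕ.+ k) % p      ≡⟨ %-remove-+ʳ (toℕ r) p∣k ⟩
      toℕ r % p              ≡⟨ m<n⇒m%n≡m (FinP.toℕ<n r) ⟩
      toℕ r                  ∎)

module BlockRotation (m p : ℕ) .{{_ : NonZero p}} where
  open Rotation p

  block-rotate : Fin (m ℕ.* p) → Fin (m ℕ.* p)
  block-rotate i = combine (proj₁ (remQuot {m} p i)) (rotate (proj₂ (remQuot {m} p i)))

  iter-block-rotate : ∀ k (b : Fin m) (r : Fin p) → iter k block-rotate (combine b r) ≡ combine b (iter k rotate r)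
  iter-block-rotate zero    b r = ≡.refl
  iter-block-rotate (suc k) b r = ≡.trans (cong block-rotate (iter-block-rotate k b r))
    (cong (λ (b′ , r′) → combine b′ (rotate r′)) (FinP.remQuot-combine b (iter k rotate r)))

  block-rotate-returns⇔ : ∀ i k → iter k block-rotate i ≡ i ⇔ p ∣ k
  block-rotate-returns⇔ i k =
    ≡.subst (λ j → iter k block-rotate j ≡ j ⇔ p ∣ k) (FinP.combine-remQuot {m} p i)
      (on-blocks (proj₁ (remQuot {m} p i)) (proj₂ (remQuot {m} p i)))
    where
    on-blocks : ∀ (b : Fin m) (r : Fin p) → iter k block-rotate (combine b r) ≡ combine b r ⇔ p ∣ k
    on-blocks b r = rotate-returns⇔ k r ⇔-∘ mk⇔
      (λ returns → FinP.combine-injectiveʳ b _ b r (≡.trans (≡.sym (iter-block-rotate k b r)) returns))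
      (λ returns → ≡.trans (iter-block-rotate k b r) (cong (combine b) returns))

module Transport {A : Set} (_≟ᴬ_ : DecidableEquality A) {M} (e : Fin M → A)
  (e-injective : ∀ {i j} → e i ≡ e j → i ≡ j) (s : Fin M → Fin M) where

  σ : A → A
  σ x with FinP.any? (λ i → e i ≟ᴬ x)
  ... | yes (i , _) = e (s i)
  ... | no  _       = x

  σ-e : ∀ i → σ (e i) ≡ e (s i)
  σ-e i with FinP.any? (λ j → e j ≟ᴬ e i)
  ... | yes (j , ej≡ei) = cong (e ∘ s) (e-injective ej≡ei)
  ... | no  none        = ⊥-elim (none (i , ≡.refl))

  iter-σ : ∀ k i → iter k σ (e i) ≡ e (iter k s i)
  iter-σ zero    i = ≡.refl
  iter-σ (suc k) i = ≡.trans (cong σ (iter-σ k i)) (σ-e (iter k s i))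

  σ-returns⇔ : ∀ k i → iter k σ (e i) ≡ e i ⇔ iter k s i ≡ i
  σ-returns⇔ k i = mk⇔ (λ returns → e-injective (≡.trans (≡.sym (iter-σ k i)) returns))
                       (λ returns → ≡.trans (iter-σ k i) (cong e returns))

cycles-on-family : ∀ {A : Set} → DecidableEquality A → ∀ {M} (e : Fin M → A) →
  (∀ {i j} → e i ≡ e j → i ≡ j) → ∀ p .{{_ : NonZero p}} → p ∣ M →
  Σ (A → A) λ σ → (∀ i → ∃ λ j → σ (e i) ≡ e j) × (∀ i k → iter k σ (e i) ≡ e i ⇔ p ∣ k)
cycles-on-family _≟ᴬ_ e e-injective p (divides m ≡.refl) =
  σ , (λ i → block-rotate i , σ-e i) , (λ i k → block-rotate-returns⇔ i k ⇔-∘ σ-returns⇔ k i)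
  where
  open BlockRotation m p
  open Transport _≟ᴬ_ e e-injective block-rotate

lookup-injective : ∀ {A : Set} {xs : List A} → Unique xs → ∀ {i j} → lookup xs i ≡ lookup xs j → i ≡ j
lookup-injective {xs = x ∷ xs} (x∉xs ∷ u) {Fin.zero}  {Fin.zero}  _ = ≡.refl
lookup-injective {xs = x ∷ xs} (x∉xs ∷ u) {Fin.zero}  {Fin.suc j} x≡ = ⊥-elim (All.lookup x∉xs (∈-lookup j) x≡)
lookup-injective {xs = x ∷ xs} (x∉xs ∷ u) {Fin.suc i} {Fin.zero}  ≡x = ⊥-elim (All.lookup x∉xs (∈-lookup i) (≡.sym ≡x))
lookup-injective {xs = x ∷ xs} (x∉xs ∷ u) {Fin.suc i} {Fin.suc j} eq = cong Fin.suc (lookup-injective u eq)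

module _ {N a} {C : Pred (Fin N) a} (C? : Decidable C) where

  members : List (Fin N)
  members = filter C? (allFin N)

  members-unique : Unique members
  members-unique = Unique.filter⁺ C? (Unique.allFin⁺ N)

  member : ∀ x → C x → x ∈ₗ members
  member x cx = ∈-filter⁺ C? (∈-allFin x) cx

  cycles : ∀ p .{{_ : NonZero p}} → p ∣ count C? →
    Σ (Fin N → Fin N) λ σ → (∀ x → C x → C (σ x)) × (∀ x → C x → ∀ k → iter k σ x ≡ x ⇔ p ∣ k)
  cycles p p∣size
    with σ , σ-closed , σ-returns⇔ ←
         cycles-on-family FinP._≟_ (lookup members) (lookup-injective members-unique) p
           (≡.subst (p ∣_) (≡.sym (length-filter-allFin C?)) p∣size)
    = σ , closed , returns⇔
    where
    closed : ∀ x → C x → C (σ x)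
    closed x cx with j , σx≡ ← σ-closed (index (member x cx))
      = ≡.subst C (≡.sym (≡.trans (cong σ (lookup-index (member x cx))) σx≡))
          (proj₂ (∈-filter⁻ C? {xs = allFin N} (∈-lookup j)))
    returns⇔ : ∀ x → C x → ∀ k → iter k σ x ≡ x ⇔ p ∣ k
    returns⇔ x cx k = ≡.subst (λ y → iter k σ y ≡ y ⇔ p ∣ k) (≡.sym (lookup-index (member x cx)))
      (σ-returns⇔ (index (member x cx)) k)

realize-periods : ∀ {N a} {Y : Pred (Fin N) a} (Y? : Decidable Y) (per : Fin N → ℕ) →
  (∀ x → NonZero (per x)) → (∀ d → d ∣ count (period-class? Y? per d)) →
  Σ (Fin N → Fin N) λ τ → (∀ x → Y x → Y (τ x)) × (∀ x → Y x → ∀ k → iter k τ x ≡ x ⇔ per x ∣ k)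
realize-periods {N} {a} {Y} Y? per per≢0 class-divisible = τ , τ-closed , τ-returns⇔
  where
  Class : ℕ → Pred (Fin N) a
  Class d x = Y x × per x ≡ d

  σ : ∀ d .{{_ : NonZero d}} → Fin N → Fin N
  σ d = proj₁ (cycles (period-class? Y? per d) d (class-divisible d))

  σ-closed : ∀ d .{{_ : NonZero d}} x → Class d x → Class d (σ d x)
  σ-closed d = proj₁ (proj₂ (cycles (period-class? Y? per d) d (class-divisible d)))

  σ-returns⇔ : ∀ d .{{_ : NonZero d}} x → Class d x → ∀ k → iter k (σ d) x ≡ x ⇔ d ∣ k
  σ-returns⇔ d = proj₂ (proj₂ (cycles (period-class? Y? per d) d (class-divisible d)))

  τ : Fin N → Fin N
  τ x with Y? x
  ... | yes _ = σ (per x) {{per≢0 x}} x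
  ... | no  _ = x

  τ-on-class : ∀ d .{{_ : NonZero d}} x → Class d x → τ x ≡ σ d x
  τ-on-class d x (x∈Y , ≡.refl) with Y? x
  ... | yes _   = ≡.refl
  ... | no  x∉Y = ⊥-elim (x∉Y x∈Y)

  iter-τ : ∀ d .{{_ : NonZero d}} x → Class d x → ∀ k →
    (iter k τ x ≡ iter k (σ d) x) × Class d (iter k (σ d) x)
  iter-τ d x cx zero = ≡.refl , cx
  iter-τ d x cx (suc k) with τᵏx≡σᵏx , cσᵏx ← iter-τ d x cx k =
    ≡.trans (cong τ τᵏx≡σᵏx) (τ-on-class d _ cσᵏx) , σ-closed d _ cσᵏx

  own-class : ∀ x → Y x → Class (per x) x
  own-class x x∈Y = x∈Y , ≡.refl

  τ-closed : ∀ x → Y x → Y (τ x)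
  τ-closed x x∈Y = ≡.subst Y (≡.sym (τ-on-class (per x) {{per≢0 x}} x (own-class x x∈Y)))
    (proj₁ (σ-closed (per x) {{per≢0 x}} x (own-class x x∈Y)))

  τ-returns⇔ : ∀ x → Y x → ∀ k → iter k τ x ≡ x ⇔ per x ∣ k
  τ-returns⇔ x x∈Y k = σ-returns⇔ (per x) {{per≢0 x}} x (own-class x x∈Y) k ⇔-∘ mk⇔
    (λ returns → ≡.trans (≡.sym τᵏx≡σᵏx) returns) (λ returns → ≡.trans τᵏx≡σᵏx returns)
    where
    τᵏx≡σᵏx : iter k τ x ≡ iter k (σ (per x) {{per≢0 x}}) x
    τᵏx≡σᵏx = proj₁ (iter-τ (per x) {{per≢0 x}} x (own-class x x∈Y) k)

module Orbits {N} (n : ℕ) .{{_ : NonZero n}} (g : Fin N → Fin N) (g-action : IsCnAction n g) where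

  private
    stabilizer-of : ∀ x → Σ ℕ λ q → ∀ k → iter k g x ≡ x ⇔ suc q ∣ k
    stabilizer-of x = stabilizer FinP._≟_ g x (pred n)
      (≡.subst (λ m → iter m g x ≡ x) (≡.sym (ℕₚ.suc-pred n)) (g-action x))

  period : Fin N → ℕ
  period x = suc (proj₁ (stabilizer-of x))

  period-returns⇔ : ∀ x k → iter k g x ≡ x ⇔ period x ∣ k
  period-returns⇔ x = proj₂ (stabilizer-of x)

  period∣n : ∀ x → period x ∣ n
  period∣n x = Equivalence.to (period-returns⇔ x n) (g-action x)

  cofactor : Fin N → ℕ
  cofactor x = quotient (period∣n x)

  cofactor·period≡n : ∀ x → cofactor x ℕ.* period x ≡ n
  cofactor·period≡n x = ≡.sym (m∣n⇒n≡quotient*m (period∣n x))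

proposition5p3 : {c ℓ : Level} (R : CommutativeRing c ℓ) → IsChar0Domain R →
    (n : ℕ) → 1 ≤ n → (ω : CommutativeRing.Carrier R) → IsPrimitiveRoot R n ω →
    (N : ℕ) (Y : Subset N) (g : Fin N → Fin N) → IsCnAction n g →
    (f : Poly) → evalAt1 f ≡ ∣ Y ∣ →
    (∀ k → 1 ≤ k → k ≤ n →
      CommutativeRing._≈_ R (evalR R f (pow R ω k)) (ℕ→R R (fixCount Y (iter k g)))) →
    Σ (Fin N → Fin N) λ τ → IsCnActionOn n Y τ ×
      (∀ k → 1 ≤ k → k ≤ n →
        CommutativeRing._≈_ R (evalR R f (pow R ω k)) (ℕ→R R (fixCount Y (iter k τ))))
proposition5p3 R domain n 1≤n ω ω-primitive N Y g g-action f _ sieving =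
  τ , (τ-closed , λ x x∈Y → Equivalence.from (τ-returns⇔ x x∈Y n) (period∣n x)) , τ-sieves
  where
  instance
    n≢0 : NonZero n
    n≢0 = >-nonZero 1≤n
  open CommutativeRing R using (_≈_)
  open RingFacts.PrimitiveRoot R domain n ω ω-primitive using (transform-divisible)
  open Orbits n g g-action

  open PeriodClasses n (_∈? Y) period cofactor cofactor·period≡n
    (transform-divisible f Y g period cofactor cofactor·period≡n (λ x _ → period-returns⇔ x) sieving)

  rearrangement : Σ (Fin N → Fin N) λ τ →
    (∀ x → x ∈ Y → τ x ∈ Y) × (∀ x → x ∈ Y → ∀ k → iter k τ x ≡ x ⇔ period x ∣ k)
  rearrangement = realize-periods (_∈? Y) period (λ _ → _) class-size-divisible

  τ : Fin N → Fin N
  τ = proj₁ rearrangement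

  τ-closed : ∀ x → x ∈ Y → τ x ∈ Y
  τ-closed = proj₁ (proj₂ rearrangement)

  τ-returns⇔ : ∀ x → x ∈ Y → ∀ k → iter k τ x ≡ x ⇔ period x ∣ k
  τ-returns⇔ = proj₂ (proj₂ rearrangement)

  -- Fixed points are determined by periods, so τ has the same fixed-point counts as g.
  τ-sieves : ∀ k → 1 ≤ k → k ≤ n → evalR R f (pow R ω k) ≈ ℕ→R R (fixCount Y (iter k τ))
  τ-sieves k 1≤k k≤n = ≡.subst (λ m → evalR R f (pow R ω k) ≈ ℕ→R R m)
    (≡.trans (fixCount-by-period Y (iter k g) period k (λ x _ → period-returns⇔ x k))
             (≡.sym (fixCount-by-period Y (iter k τ) period k (λ x x∈Y → τ-returns⇔ x x∈Y k))))
    (sieving k 1≤k k≤n)
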